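{- There is an absolute constant $C>0$ such that for every integer $t\ge 2$, every $2$-coloring of the edges of the complete graph on $2^t$ vertices contains at least $2^{t^2/4-t\log_2 t-Ct}$ monochromatic complete subgraphs whose size $r$ satisfies $t\left(1-\sqrt{\frac12}\right)\le r\le t\sqrt{\frac12}$.
   Context: A $2$-coloring of the edges of a complete graph assigns to each edge one of two colors, red or blue. A monochromatic complete subgraph is a set $S$ of vertices such that all edges with both endpoints in $S$ have the same color; they are counted as vertex sets, each set once, and the size of $S$ is $|S|$. -}

module Defs where

open import Data.Nat using (ℕ; _*_; _^_; _≤_; _∸_)
open import Data.Bool using (Bool)
open import Data.Fin using (Fin)
open import Data.Fin.Subset using (Subset; _∈_; ∣_∣)
open import Data.Product using (∃)
open import Relation.Binary.PropositionalEquality using (_≡_; _≢_)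

-- A 2-coloring of the edges of the complete graph K_n on vertex set Fin n:
-- a symmetric function giving each unordered pair {i,j} (i ≢ j) a colour in Bool
-- (false = red, true = blue). Values on the diagonal are irrelevant.
record Colouring (n : ℕ) : Set where
  field
    colour : Fin n → Fin n → Bool
    symm   : ∀ i j → colour i j ≡ colour j i
open Colouring public

Monochromatic : ∀ {n} → Colouring n → Subset n → Set
Monochromatic c S =
  ∃ λ (b : Bool) → ∀ i j → i ∈ S → j ∈ S → i ≢ j → colour c i j ≡ b

-- t(1 - √(1/2)) ≤ r ≤ t √(1/2), for naturals r, t, written in integer arithmetic:
--   r ≤ t/√2        ⇔ 2 r² ≤ t²
--   t - t/√2 ≤ r    ⇔ t - r ≤ t/√2 ⇔ 2 (t - r)² ≤ t²   (using r ≤ t, implied by the first)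
SizeInRange : ℕ → ℕ → Set
SizeInRange t r = (2 * (r * r) ≤ t * t) × (2 * ((t ∸ r) * (t ∸ r)) ≤ t * t)
  where open import Data.Product using (_×_)

-- N ≥ 2^(t²/4 - t log₂ t - C t)
--   ⇔ N · 2^(C t) · t^t ≥ 2^(t²/4)
--   ⇔ (N · 2^(C t) · t^t)^4 ≥ 2^(t²)
CountBound : ℕ → ℕ → ℕ → Set
CountBound C t N = 2 ^ (t * t) ≤ (N * 2 ^ (C * t) * t ^ t) ^ 4

-- The neighbourhood-halving proof of R(k, k) ≤ 4 ^ k, run while counting the cliques it finds.
-- With φ s = (s - 1 choose 2), every set of at least 2 ^ m vertices contains, for all a and b, either
-- 2 ^ φ a / a! red a-cliques (a ≤ m), or 2 ^ φ b / b! blue b-cliques (b ≤ m), or a family X of red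
-- and a family Y of blue cliques with sizes in [m - b, a] and [m - a, b] such that |X| |Y| ≥ 2 ^ φ m / m!.
-- In the induction step half of the vertices have 2 ^ (m - 1) neighbours of one colour, say red.
-- Inside each such red neighbourhood the statement for a - 1 gives a blue outcome outright, or else half
-- of these neighbourhoods give outcomes of the same kind; adding the centre to their red cliques
-- multiplies the count by 2 ^ (m - 2) and produces each clique T at most |T| times.
-- For m = t and a = b = ⌊t / √2⌋ all sizes lie in [t (1 - 1/√2), t / √2], and the counts are at least
-- 2 ^ (t² / 4) / t^t up to a factor 2 ^ O(t).

module Submission where

open import Defs
open import Data.Nat using (ℕ; zero; suc; _+_; _*_; _∸_; _^_; _≤_; _<_; _⊓_; _!; z≤n; s≤s; _≤?_; _<?_; >-nonZero)
open import Data.Nat.Properties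
open import Data.Nat.ListAction using (sum)
open import Data.Nat.Tactic.RingSolver using (solve-∀)
open import Data.Bool using (Bool; true; false)
import Data.Bool as Bool
open import Data.Fin using (Fin; zero; suc)
import Data.Fin as Fin
open import Data.Fin.Subset using (Subset; _∈_; _∉_; ∣_∣) renaming (⊥ to ∅)
open import Data.Fin.Subset.Properties using (∉⊥; ∣⊥∣≡0)
open import Data.Vec using ([]; _∷_; here; there)
open import Data.Vec.Properties using (∷-injective; ≡-dec)
open import Data.List using (List; []; _∷_; [_]; _++_; length; map; filter; deduplicate; allFin)
open import Data.List.Properties using (filter-all; length-++; length-map; length-removeAt′; length-tabulate)
open import Data.List.Membership.Propositional using () renaming (_∈_ to _∈ₗ_)
open import Data.List.Membership.Propositional.Properties
  using (∈-map⁺; ∈-map⁻; ∈-++⁺ˡ; ∈-++⁺ʳ; ∈-++⁻; ∈-filter⁻; ∈-deduplicate⁻; ∈-deduplicate⁺)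
open import Data.List.Relation.Unary.Any using (here; there; index; _─_)
open import Data.List.Relation.Unary.All as All using (All; []; _∷_)
import Data.List.Relation.Unary.All.Properties as All
open import Data.List.Relation.Unary.AllPairs using ([]; _∷_)
open import Data.List.Relation.Unary.Unique.Propositional using (Unique)
import Data.List.Relation.Unary.Unique.Propositional.Properties as Unique
import Data.List.Relation.Unary.Unique.DecPropositional.Properties as UniqueDec
open import Data.List.Relation.Binary.Disjoint.Propositional using (Disjoint)
open import Data.Product using (Σ; _×_; _,_; proj₁; proj₂; uncurry)
open import Data.Sum using (_⊎_; inj₁; inj₂)
open import Data.Empty using (⊥-elim)
open import Function using (_∘_; id)
open import Relation.Nullary using (¬_; ¬?; Dec; yes; no)
open import Relation.Unary using (Decidable)
open import Relation.Binary.Definitions using (DecidableEquality)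
open import Relation.Binary.PropositionalEquality hiding ([_])

module _ {A : Set} where

  ∈-─ : ∀ {x z} (ys : List A) (x∈ : x ∈ₗ ys) → z ∈ₗ ys → x ≢ z → z ∈ₗ (ys ─ x∈)
  ∈-─ (y ∷ ys) (here refl) (here refl) x≢z = ⊥-elim (x≢z refl)
  ∈-─ (y ∷ ys) (here refl) (there z∈)  _   = z∈
  ∈-─ (y ∷ ys) (there x∈)  (here refl) _   = here refl
  ∈-─ (y ∷ ys) (there x∈)  (there z∈)  x≢z = there (∈-─ ys x∈ z∈ x≢z)

  Unique-⊆⇒length≤ : ∀ {xs ys : List A} → Unique xs → All (_∈ₗ ys) xs → length xs ≤ length ys
  Unique-⊆⇒length≤ {[]}         _             _           = z≤n
  Unique-⊆⇒length≤ {x ∷ xs} {ys} (x∉xs ∷ !xs) (x∈ ∷ xs⊆) =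
    subst (suc (length xs) ≤_) (sym (length-removeAt′ ys (index x∈)))
      (s≤s (Unique-⊆⇒length≤ !xs (All.zipWith (λ (z∈ , x≢z) → ∈-─ ys x∈ z∈ x≢z) (xs⊆ , x∉xs))))

  length≤1+length-filter-≢ : (_≟_ : DecidableEquality A) (v : A) {xs : List A} → Unique xs →
    length xs ≤ suc (length (filter (λ u → ¬? (u ≟ v)) xs))
  length≤1+length-filter-≢ _≟_ v {[]}     _             = z≤n
  length≤1+length-filter-≢ _≟_ v {x ∷ xs} (x∉xs ∷ !xs) with x ≟ v
  ... | yes refl = s≤s (≤-reflexive (sym (cong length (filter-all (λ u → ¬? (u ≟ x)) (All.map ≢-sym x∉xs)))))
  ... | no _     = s≤s (length≤1+length-filter-≢ _≟_ v !xs)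

  length≤filter+filter : {P Q : A → Set} (P? : Decidable P) (Q? : Decidable Q) → (∀ a → P a ⊎ Q a) →
    (xs : List A) → length xs ≤ length (filter P? xs) + length (filter Q? xs)
  length≤filter+filter P? Q? P⊎Q [] = z≤n
  length≤filter+filter P? Q? P⊎Q (x ∷ xs) with P? x | Q? x | P⊎Q x
  ... | yes _ | yes _ | _     = s≤s (≤-trans (length≤filter+filter P? Q? P⊎Q xs) (+-monoʳ-≤ _ (n≤1+n _)))
  ... | yes _ | no _  | _     = s≤s (length≤filter+filter P? Q? P⊎Q xs)
  ... | no _  | yes _ | _     = subst (suc (length xs) ≤_) (sym (+-suc _ _)) (s≤s (length≤filter+filter P? Q? P⊎Q xs))
  ... | no ¬p | no _  | inj₁ p = ⊥-elim (¬p p)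
  ... | no _  | no ¬q | inj₂ q = ⊥-elim (¬q q)

module _ {A B : Set} (f : A → B) where

  Unique-map⁺-injectiveOn : ∀ {xs} → Unique xs → (∀ {a b} → a ∈ₗ xs → b ∈ₗ xs → f a ≡ f b → a ≡ b) →
    Unique (map f xs)
  Unique-map⁺-injectiveOn {[]}     _             _   = []
  Unique-map⁺-injectiveOn {x ∷ xs} (x∉xs ∷ !xs) inj =
    All.map⁺ (All.tabulate λ z∈ fx≡fz → All.lookup x∉xs z∈ (inj (here refl) (there z∈) fx≡fz))
    ∷ Unique-map⁺-injectiveOn !xs (λ a∈ b∈ → inj (there a∈) (there b∈))

module _ {E : Set} (f : E → ℕ) where

  length*≤sum* : ∀ {K F} (es : List E) → All (λ e → K ≤ f e * F) es → length es * K ≤ sum (map f es) * F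
  length*≤sum* []       _        = z≤n
  length*≤sum* {K} {F} (e ∷ es) (h ∷ hs) = begin
    K + length es * K             ≤⟨ +-mono-≤ h (length*≤sum* es hs) ⟩
    f e * F + sum (map f es) * F  ≡⟨ *-distribʳ-+ F (f e) (sum (map f es)) ⟨
    (f e + sum (map f es)) * F    ∎
    where open ≤-Reasoning

  ∃-length*≤sum : (e : E) (es : List E) → Σ E λ m → length (e ∷ es) * f m ≤ sum (map f (e ∷ es))
  ∃-length*≤sum e []        = e , ≤-refl
  ∃-length*≤sum e (e′ ∷ es) with ∃-length*≤sum e′ es
  ... | m , h with f e ≤? f m
  ...   | yes fe≤fm = e , +-monoʳ-≤ (f e) (≤-trans (*-monoʳ-≤ (suc (length es)) fe≤fm) h)
  ...   | no  fe≰fm = m , +-mono-≤ (≰⇒≥ fe≰fm) h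

  sum≤length* : ∀ {μ} (es : List E) → All (λ e → f e ≤ μ) es → sum (map f es) ≤ length es * μ
  sum≤length* []       _        = z≤n
  sum≤length* (e ∷ es) (h ∷ hs) = +-mono-≤ h (sum≤length* es hs)

module _ {E B C : Set} (key : E → B) (vals : E → List C) where

  pairs : List E → List (B × C)
  pairs []       = []
  pairs (e ∷ es) = map (key e ,_) (vals e) ++ pairs es

  length-pairs : ∀ es → length (pairs es) ≡ sum (map (length ∘ vals) es)
  length-pairs []       = refl
  length-pairs (e ∷ es) = begin
    length (map (key e ,_) (vals e) ++ pairs es)          ≡⟨ length-++ (map (key e ,_) (vals e)) ⟩
    length (map (key e ,_) (vals e)) + length (pairs es)  ≡⟨ cong₂ _+_ (length-map (key e ,_) (vals e)) (length-pairs es) ⟩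
    length (vals e) + sum (map (length ∘ vals) es)        ∎
    where open ≡-Reasoning

  ∈-pairs⁺ : ∀ {e c} es → e ∈ₗ es → c ∈ₗ vals e → (key e , c) ∈ₗ pairs es
  ∈-pairs⁺ (e ∷ es)  (here refl) c∈ = ∈-++⁺ˡ (∈-map⁺ (key e ,_) c∈)
  ∈-pairs⁺ (e′ ∷ es) (there e∈)  c∈ = ∈-++⁺ʳ (map (key e′ ,_) (vals e′)) (∈-pairs⁺ es e∈ c∈)

  ∈-pairs⁻ : ∀ es {b c} → (b , c) ∈ₗ pairs es → Σ E λ e → e ∈ₗ es × b ≡ key e × c ∈ₗ vals e
  ∈-pairs⁻ (e ∷ es) w∈ with ∈-++⁻ (map (key e ,_) (vals e)) w∈
  ... | inj₁ w∈ₑ with ∈-map⁻ (key e ,_) w∈ₑ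
  ...   | c , c∈ , refl = e , here refl , refl , c∈
  ∈-pairs⁻ (e ∷ es) w∈ | inj₂ w∈ₛ with ∈-pairs⁻ es w∈ₛ
  ...   | e′ , e′∈ , eq , c∈ = e′ , there e′∈ , eq , c∈

  Unique-pairs : ∀ es → Unique (map key es) → All (Unique ∘ vals) es → Unique (pairs es)
  Unique-pairs []       _              _            = []
  Unique-pairs (e ∷ es) (k∉keys ∷ !ks) (!vs ∷ !vss) =
    Unique.++⁺ (Unique.map⁺ (λ eq → cong proj₂ eq) !vs) (Unique-pairs es !ks !vss) disjoint
    where
    disjoint : Disjoint (map (key e ,_) (vals e)) (pairs es)
    disjoint (w∈ₑ , w∈ₛ) with ∈-map⁻ (key e ,_) w∈ₑ
    ... | c , _ , refl with ∈-pairs⁻ es w∈ₛ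
    ...   | e′ , e′∈ , k≡ , _ = All.lookup k∉keys (∈-map⁺ key e′∈) k≡

insert : ∀ {n} → Fin n → Subset n → Subset n
insert zero    (_ ∷ p) = true ∷ p
insert (suc i) (x ∷ p) = x ∷ insert i p

x∈insert[x] : ∀ {n} (v : Fin n) S → v ∈ insert v S
x∈insert[x] zero    (_ ∷ p) = here
x∈insert[x] (suc i) (x ∷ p) = there (x∈insert[x] i p)

∈-insert⁻ : ∀ {n} {u} (v : Fin n) S → u ∈ insert v S → u ≡ v ⊎ u ∈ S
∈-insert⁻ zero    (_ ∷ p) here      = inj₁ refl
∈-insert⁻ zero    (_ ∷ p) (there q) = inj₂ (there q)
∈-insert⁻ (suc i) (x ∷ p) here      = inj₂ here
∈-insert⁻ (suc i) (x ∷ p) (there q) with ∈-insert⁻ i p q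
... | inj₁ refl = inj₁ refl
... | inj₂ q∈p  = inj₂ (there q∈p)

∣insert∣ : ∀ {n} (v : Fin n) S → v ∉ S → ∣ insert v S ∣ ≡ suc ∣ S ∣
∣insert∣ zero    (true  ∷ p) v∉S = ⊥-elim (v∉S here)
∣insert∣ zero    (false ∷ p) v∉S = refl
∣insert∣ (suc i) (true  ∷ p) v∉S = cong suc (∣insert∣ i p (v∉S ∘ there))
∣insert∣ (suc i) (false ∷ p) v∉S = ∣insert∣ i p (v∉S ∘ there)

insert-injective : ∀ {n} (v : Fin n) {S S′} → v ∉ S → v ∉ S′ → insert v S ≡ insert v S′ → S ≡ S′
insert-injective zero    {true  ∷ _} {_}         v∉S _    _  = ⊥-elim (v∉S here)
insert-injective zero    {false ∷ _} {true  ∷ _} _   v∉S′ _  = ⊥-elim (v∉S′ here)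
insert-injective zero    {false ∷ _} {false ∷ _} _   _    eq = cong (false ∷_) (proj₂ (∷-injective eq))
insert-injective (suc i) {x ∷ p} {x′ ∷ p′} v∉S v∉S′ eq with ∷-injective eq
... | refl , eq′ = cong (x ∷_) (insert-injective i (v∉S ∘ there) (v∉S′ ∘ there) eq′)

elements : ∀ {n} → Subset n → List (Fin n)
elements []          = []
elements (true  ∷ p) = zero ∷ map suc (elements p)
elements (false ∷ p) = map suc (elements p)

length-elements : ∀ {n} (p : Subset n) → length (elements p) ≡ ∣ p ∣
length-elements []          = refl
length-elements (true  ∷ p) = cong suc (trans (length-map suc (elements p)) (length-elements p))
length-elements (false ∷ p) = trans (length-map suc (elements p)) (length-elements p)

∈-elements : ∀ {n} {u : Fin n} (p : Subset n) → u ∈ p → u ∈ₗ elements p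
∈-elements (true  ∷ p) here      = here refl
∈-elements (true  ∷ p) (there q) = there (∈-map⁺ suc (∈-elements p q))
∈-elements (false ∷ p) (there q) = ∈-map⁺ suc (∈-elements p q)

m+m≤1+n+o⇒m≤n⊎m≤o : ∀ {m} n o → m + m ≤ suc (n + o) → m ≤ n ⊎ m ≤ o
m+m≤1+n+o⇒m≤n⊎m≤o {m} n o h with m ≤? n | m ≤? o
... | yes m≤n | _       = inj₁ m≤n
... | no _    | yes m≤o = inj₂ m≤o
... | no m≰n  | no m≰o  = ⊥-elim (<⇒≱ (subst (λ z → suc z ≤ m + m) (+-suc n o) (+-mono-≤ (≰⇒> m≰n) (≰⇒> m≰o))) h)

2^m+2^m≡2^[1+m] : ∀ m → 2 ^ m + 2 ^ m ≡ 2 ^ suc m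
2^m+2^m≡2^[1+m] m = cong (2 ^ m +_) (sym (+-identityʳ (2 ^ m)))

2^[m∸1]+2^[m∸1]≤1+2^m : ∀ m → 2 ^ (m ∸ 1) + 2 ^ (m ∸ 1) ≤ suc (2 ^ m)
2^[m∸1]+2^[m∸1]≤1+2^m zero    = s≤s (s≤s z≤n)
2^[m∸1]+2^[m∸1]≤1+2^m (suc m) = m≤n⇒m≤1+n (≤-reflexive (2^m+2^m≡2^[1+m] m))

m∸n≤1+m∸[1+n] : ∀ m n → m ∸ n ≤ suc (m ∸ suc n)
m∸n≤1+m∸[1+n] zero    zero    = z≤n
m∸n≤1+m∸[1+n] zero    (suc n) = z≤n
m∸n≤1+m∸[1+n] (suc m) zero    = ≤-refl
m∸n≤1+m∸[1+n] (suc m) (suc n) = m∸n≤1+m∸[1+n] m n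

-- φ s = (s ∸ 1) choose 2.
φ : ℕ → ℕ
φ zero    = 0
φ (suc s) = φ s + (s ∸ 1)

module _ {n : ℕ} (c : Colouring n) where

  IsClique : Bool → Subset n → Set
  IsClique x S = ∀ i j → i ∈ S → j ∈ S → i ≢ j → colour c i j ≡ x

  _⊆ₗ_ : Subset n → List (Fin n) → Set
  S ⊆ₗ A = ∀ {i} → i ∈ S → i ∈ₗ A

  neighbours : Bool → Fin n → List (Fin n) → List (Fin n)
  neighbours x v A = filter (λ u → colour c v u Bool.≟ x) (filter (λ u → ¬? (u Fin.≟ v)) A)

  ∈-neighbours⁻ : ∀ x v A {u} → u ∈ₗ neighbours x v A → u ∈ₗ A × u ≢ v × colour c v u ≡ x
  ∈-neighbours⁻ x v A u∈ with ∈-filter⁻ (λ u → colour c v u Bool.≟ x) u∈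
  ... | u∈′ , vu≡x with ∈-filter⁻ (λ u → ¬? (u Fin.≟ v)) {xs = A} u∈′
  ...   | u∈A , u≢v = u∈A , u≢v , vu≡x

  neighbours⊆ : ∀ x v A {i} → i ∈ₗ neighbours x v A → i ∈ₗ A
  neighbours⊆ x v A i∈ = proj₁ (∈-neighbours⁻ x v A i∈)

  Unique-neighbours : ∀ x v {A} → Unique A → Unique (neighbours x v A)
  Unique-neighbours x v !A = Unique.filter⁺ _ (Unique.filter⁺ _ !A)

  length≤1+degrees : ∀ v {A} → Unique A →
    length A ≤ suc (length (neighbours false v A) + length (neighbours true v A))
  length≤1+degrees v {A} !A = ≤-trans (length≤1+length-filter-≢ Fin._≟_ v !A)
    (s≤s (length≤filter+filter (λ u → colour c v u Bool.≟ false) (λ u → colour c v u Bool.≟ true)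
      (λ u → false⊎true (colour c v u)) (filter (λ u → ¬? (u Fin.≟ v)) A)))
    where
    false⊎true : ∀ b → b ≡ false ⊎ b ≡ true
    false⊎true false = inj₁ refl
    false⊎true true  = inj₂ refl

  large-degree : ∀ m v {A} → Unique A → 2 ^ suc m ≤ length A →
    2 ^ m ≤ length (neighbours false v A) ⊎ 2 ^ m ≤ length (neighbours true v A)
  large-degree m v !A large = m+m≤1+n+o⇒m≤n⊎m≤o _ _
    (≤-trans (≤-trans (≤-reflexive (2^m+2^m≡2^[1+m] m)) large) (length≤1+degrees v !A))

  record SizedClique (x : Bool) (A : List (Fin n)) (lo hi : ℕ) (S : Subset n) : Set where
    field
      clique : IsClique x S
      within : S ⊆ₗ A
      lower  : lo ≤ ∣ S ∣
      upper  : ∣ S ∣ ≤ hi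

  CliqueFamily : Bool → List (Fin n) → ℕ → ℕ → List (Subset n) → Set
  CliqueFamily x A lo hi L = Unique L × All (SizedClique x A lo hi) L

  CliqueFamily-weaken : ∀ {x A A′ lo lo′ hi hi′ L} → (∀ {i} → i ∈ₗ A → i ∈ₗ A′) → lo′ ≤ lo → hi ≤ hi′ →
    CliqueFamily x A lo hi L → CliqueFamily x A′ lo′ hi′ L
  CliqueFamily-weaken A⊆A′ lo′≤lo hi≤hi′ (!L , cliques) = !L , All.map weaken cliques
    where
    weaken : ∀ {S} → SizedClique _ _ _ _ S → SizedClique _ _ _ _ S
    weaken K = record
      { clique = clique ; within = A⊆A′ ∘ within
      ; lower = ≤-trans lo′≤lo lower ; upper = ≤-trans upper hi≤hi′ }
      where open SizedClique K

  centre∉ : ∀ x v A {lo hi S} → SizedClique x (neighbours x v A) lo hi S → v ∉ S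
  centre∉ x v A K v∈S = proj₁ (proj₂ (∈-neighbours⁻ x v A (SizedClique.within K v∈S))) refl

  insert-SizedClique : ∀ {x v A lo hi S} → v ∈ₗ A → SizedClique x (neighbours x v A) lo hi S →
    SizedClique x A (suc lo) (suc hi) (insert v S)
  insert-SizedClique {x} {v} {A} {S = S} v∈A K = record
    { clique = clique′ ; within = within′
    ; lower = subst (suc _ ≤_) (sym size) (s≤s lower)
    ; upper = subst (_≤ suc _) (sym size) (s≤s upper) }
    where
    open SizedClique K
    size = ∣insert∣ v S (centre∉ x v A K)
    adjacent : ∀ j → j ∈ S → colour c v j ≡ x
    adjacent j j∈S = proj₂ (proj₂ (∈-neighbours⁻ x v A (within j∈S)))
    clique′ : IsClique x (insert v S)
    clique′ i j i∈ j∈ i≢j with ∈-insert⁻ v S i∈ | ∈-insert⁻ v S j∈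
    ... | inj₁ refl | inj₁ refl = ⊥-elim (i≢j refl)
    ... | inj₁ refl | inj₂ j∈S  = adjacent j j∈S
    ... | inj₂ i∈S  | inj₁ refl = trans (symm c i v) (adjacent i i∈S)
    ... | inj₂ i∈S  | inj₂ j∈S  = clique i j i∈S j∈S i≢j
    within′ : insert v S ⊆ₗ A
    within′ {i} i∈ with ∈-insert⁻ v S i∈
    ... | inj₁ refl = v∈A
    ... | inj₂ i∈S  = neighbours⊆ x v A (within i∈S)

  RootedClique : Bool → List (Fin n) → ℕ → ℕ → Fin n × Subset n → Set
  RootedClique x A lo hi (v , S) = v ∈ₗ A × SizedClique x (neighbours x v A) lo hi S

  -- Each clique T of the result arises from at most ∣ T ∣ ≤ suc hi pairs (v , S), one per choice of v ∈ T.
  extend : ∀ x A lo hi (Z : List (Fin n × Subset n)) → Unique Z → All (RootedClique x A lo hi) Z →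
    Σ (List (Subset n)) λ D → CliqueFamily x A (suc lo) (suc hi) D × length Z ≤ length D * suc hi
  extend x A lo hi Z !Z rooted = D , (UniqueDec.deduplicate-! _≟ₛ_ (map join Z) , All.tabulate member) , count
    where
    _≟ₛ_ = ≡-dec Bool._≟_
    join = uncurry insert
    D = deduplicate _≟ₛ_ (map join Z)

    member : ∀ {T} → T ∈ₗ D → SizedClique x A (suc lo) (suc hi) T
    member T∈D with ∈-map⁻ join (∈-deduplicate⁻ _≟ₛ_ (map join Z) T∈D)
    ... | w , w∈Z , refl = insert-SizedClique (proj₁ (All.lookup rooted w∈Z)) (proj₂ (All.lookup rooted w∈Z))

    flag : Fin n × Subset n → Subset n × Fin n
    flag (v , S) = insert v S , v

    flag-injective : ∀ {w w′} → w ∈ₗ Z → w′ ∈ₗ Z → flag w ≡ flag w′ → w ≡ w′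
    flag-injective {v , S} {v′ , S′} w∈Z w′∈Z eq with cong proj₂ eq
    ... | refl = cong (v ,_) (insert-injective v (v∉ w∈Z) (v∉ w′∈Z) (cong proj₁ eq))
      where
      v∉ : ∀ {S} → (v , S) ∈ₗ Z → v ∉ S
      v∉ w∈Z = centre∉ x v A (proj₂ (All.lookup rooted w∈Z))

    count : length Z ≤ length D * suc hi
    count = begin
      length Z                          ≡⟨ length-map flag Z ⟨
      length (map flag Z)               ≤⟨ Unique-⊆⇒length≤ (Unique-map⁺-injectiveOn flag !Z flag-injective)
                                             (All.map⁺ (All.tabulate flagged)) ⟩
      length (pairs id elements D)      ≡⟨ length-pairs id elements D ⟩
      sum (map (length ∘ elements) D)   ≤⟨ sum≤length* (length ∘ elements) D (All.tabulate bounded) ⟩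
      length D * suc hi                 ∎
      where
      open ≤-Reasoning
      flagged : ∀ {w} → w ∈ₗ Z → flag w ∈ₗ pairs id elements D
      flagged {v , S} w∈Z =
        ∈-pairs⁺ id elements D (∈-deduplicate⁺ _≟ₛ_ (∈-map⁺ join w∈Z)) (∈-elements _ (x∈insert[x] v S))
      bounded : ∀ {T} → T ∈ₗ D → length (elements T) ≤ suc hi
      bounded {T} T∈D = subst (_≤ suc hi) (sym (length-elements T)) (SizedClique.upper (member T∈D))

  record Star (x : Bool) (A : List (Fin n)) (lo hi : ℕ) : Set where
    constructor mkStar
    field
      centre   : Fin n
      centre∈A : centre ∈ₗ A
      family   : List (Subset n)
      isFamily : CliqueFamily x (neighbours x centre A) lo hi family

  open Star

  extend-stars : ∀ {x A lo hi} {E : Set} (star : E → Star x A lo hi) (P : List E) →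
    Unique (map (centre ∘ star) P) → Σ (List (Subset n)) λ D →
      CliqueFamily x A (suc lo) (suc hi) D × sum (map (length ∘ family ∘ star) P) ≤ length D * suc hi
  extend-stars {x} {A} {lo} {hi} star P !centres with extend x A lo hi Z !Z (All.tabulate rooted)
    where
    Z = pairs (centre ∘ star) (family ∘ star) P
    !Z = Unique-pairs (centre ∘ star) (family ∘ star) P !centres (All.tabulate λ {e} _ → proj₁ (isFamily (star e)))
    rooted : ∀ {w} → w ∈ₗ Z → RootedClique x A lo hi w
    rooted w∈ with ∈-pairs⁻ (centre ∘ star) (family ∘ star) P w∈
    ... | e , _ , refl , S∈ = centre∈A (star e) , All.lookup (proj₂ (isFamily (star e))) S∈
  ... | D , F , count = D , F , subst (_≤ length D * suc hi) (length-pairs (centre ∘ star) (family ∘ star) P) count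

  data Trichotomy (x y : Bool) (m : ℕ) (A : List (Fin n)) (a b : ℕ) : Set where
    x-cliques : a ≤ m → (L : List (Subset n)) → CliqueFamily x A a a L → 2 ^ φ a ≤ length L * a ! →
                Trichotomy x y m A a b
    y-cliques : b ≤ m → (L : List (Subset n)) → CliqueFamily y A b b L → 2 ^ φ b ≤ length L * b ! →
                Trichotomy x y m A a b
    mixed     : (X Y : List (Subset n)) → CliqueFamily x A (m ∸ b) (a ⊓ m) X → CliqueFamily y A (m ∸ a) (b ⊓ m) Y →
                2 ^ φ m ≤ length X * length Y * m ! → Trichotomy x y m A a b

  Trichotomy-swap : ∀ {x y m A a b} → Trichotomy x y m A a b → Trichotomy y x m A b a
  Trichotomy-swap (x-cliques a≤m L F many) = y-cliques a≤m L F many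
  Trichotomy-swap (y-cliques b≤m L F many) = x-cliques b≤m L F many
  Trichotomy-swap {m = m} (mixed X Y F G many) =
    mixed Y X G F (subst (λ N → 2 ^ φ m ≤ N * m !) (*-comm (length X) (length Y)) many)

  module InductionStep (x y : Bool) (m a b : ℕ) (A : List (Fin n)) (!A : Unique A)
    (recurse : ∀ A′ → Unique A′ → 2 ^ m ≤ length A′ → Trichotomy x y m A′ a (suc b)) where

    Target : Set
    Target = Trichotomy x y (suc m) A (suc a) (suc b)

    XStar : Set
    XStar = Σ (Star x A a a) λ s → a ≤ m × 2 ^ φ a ≤ length (family s) * a !

    MixedStar : Set
    MixedStar = Σ (Star x A (m ∸ suc b) (a ⊓ m)) λ s → Σ (List (Subset n)) λ Y →
      CliqueFamily y (neighbours x (centre s) A) (m ∸ a) (suc b ⊓ m) Y ×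
      2 ^ φ m ≤ length (family s) * length Y * m !

    LargeDegree : Fin n → Set
    LargeDegree v = v ∈ₗ A × 2 ^ m ≤ length (neighbours x v A)

    record Classified (V : List (Fin n)) : Set where
      field
        xStars        : List XStar
        mixedStars    : List MixedStar
        xCentres      : Unique (map (centre ∘ proj₁) xStars)
        mixedCentres  : Unique (map (centre ∘ proj₁) mixedStars)
        xCentres⊆     : All (_∈ₗ V) (map (centre ∘ proj₁) xStars)
        mixedCentres⊆ : All (_∈ₗ V) (map (centre ∘ proj₁) mixedStars)
        split         : length V ≡ length xStars + length mixedStars

    classify : ∀ V → Unique V → All LargeDegree V → Target ⊎ Classified V
    classify []       _           _                 = inj₂ (record
      { xStars = [] ; mixedStars = [] ; xCentres = [] ; mixedCentres = []
      ; xCentres⊆ = [] ; mixedCentres⊆ = [] ; split = refl })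
    classify (v ∷ V) (v∉V ∷ !V) ((v∈A , large) ∷ hs) with classify V !V hs
    ... | inj₁ done = inj₁ done
    ... | inj₂ C with recurse (neighbours x v A) (Unique-neighbours x v !A) large
    ...   | y-cliques b≤m L F many =
              inj₁ (y-cliques (m≤n⇒m≤1+n b≤m) L (CliqueFamily-weaken (neighbours⊆ x v A) ≤-refl ≤-refl F) many)
    ...   | x-cliques a≤m L F many = inj₂ (record
              { xStars = (mkStar v v∈A L F , a≤m , many) ∷ xStars
              ; mixedStars = mixedStars
              ; xCentres = All.map (All.lookup v∉V) xCentres⊆ ∷ xCentres
              ; mixedCentres = mixedCentres
              ; xCentres⊆ = here refl ∷ All.map there xCentres⊆
              ; mixedCentres⊆ = All.map there mixedCentres⊆
              ; split = cong suc split })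
      where open Classified C
    ...   | mixed X Y F G many = inj₂ (record
              { xStars = xStars
              ; mixedStars = (mkStar v v∈A X F , Y , G , many) ∷ mixedStars
              ; xCentres = xCentres
              ; mixedCentres = All.map (All.lookup v∉V) mixedCentres⊆ ∷ mixedCentres
              ; xCentres⊆ = All.map there xCentres⊆
              ; mixedCentres⊆ = here refl ∷ All.map there mixedCentres⊆
              ; split = trans (cong suc split) (sym (+-suc (length xStars) (length mixedStars))) })
      where open Classified C

    build-x : (P : List XStar) → Unique (map (centre ∘ proj₁) P) → 2 ^ (m ∸ 1) ≤ length P → Target
    build-x []                     _        enough = ⊥-elim (<⇒≱ (m^n>0 2 (m ∸ 1)) enough)
    build-x P@((_ , a≤m , _) ∷ _) !centres enough with extend-stars proj₁ P !centres
    ... | D , F , count = x-cliques (s≤s a≤m) D F (begin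
      2 ^ φ (suc a)                 ≡⟨ ^-distribˡ-+-* 2 (φ a) (a ∸ 1) ⟩
      2 ^ φ a * 2 ^ (a ∸ 1)         ≤⟨ *-monoʳ-≤ (2 ^ φ a) (≤-trans (^-monoʳ-≤ 2 (∸-monoˡ-≤ 1 a≤m)) enough) ⟩
      2 ^ φ a * length P            ≡⟨ *-comm (2 ^ φ a) (length P) ⟩
      length P * 2 ^ φ a            ≤⟨ length*≤sum* sizes P (All.tabulate λ {e} _ → proj₂ (proj₂ e)) ⟩
      sum (map sizes P) * a !       ≤⟨ *-monoˡ-≤ (a !) count ⟩
      length D * suc a * a !        ≡⟨ *-assoc (length D) (suc a) (a !) ⟩
      length D * suc a !            ∎)
      where
      open ≤-Reasoning
      sizes = length ∘ family ∘ proj₁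

    -- The x-families of all stars are extended together, but only one y-family can be kept: that of the
    -- star with the fewest x-cliques, so that the product bound survives the averaging.
    build-mixed : (P : List MixedStar) → Unique (map (centre ∘ proj₁) P) → 2 ^ (m ∸ 1) ≤ length P → Target
    build-mixed []         _        enough = ⊥-elim (<⇒≱ (m^n>0 2 (m ∸ 1)) enough)
    build-mixed P@(e ∷ P′) !centres enough
      with ∃-length*≤sum (length ∘ family ∘ proj₁) e P′ | extend-stars proj₁ P !centres
    ... | (s₀ , Y₀ , G₀ , many₀) , fewest | D , F , count = mixed D Y₀
      (CliqueFamily-weaken id (m∸n≤1+m∸[1+n] m b) ≤-refl F)
      (CliqueFamily-weaken (neighbours⊆ x (centre s₀) A) ≤-refl (⊓-monoʳ-≤ (suc b) (n≤1+n m)) G₀)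
      (begin
        2 ^ φ (suc m)                               ≡⟨ ^-distribˡ-+-* 2 (φ m) (m ∸ 1) ⟩
        2 ^ φ m * 2 ^ (m ∸ 1)                       ≤⟨ *-mono-≤ many₀ enough ⟩
        X₀ * Y * m ! * length P                     ≡⟨ reorder X₀ Y (m !) (length P) ⟩
        length P * X₀ * (Y * m !)                   ≤⟨ *-monoˡ-≤ (Y * m !) fewest ⟩
        sum (map (length ∘ family ∘ proj₁) P) * (Y * m !)
                                                    ≤⟨ *-monoˡ-≤ (Y * m !) (≤-trans count (*-monoʳ-≤ (length D) a⊓m<1+m)) ⟩
        length D * suc m * (Y * m !)                ≡⟨ reorder′ (length D) m Y (m !) ⟩
        length D * Y * suc m !                      ∎)
      where
      open ≤-Reasoning
      X₀ = length (family s₀)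
      Y  = length Y₀
      a⊓m<1+m = s≤s (m⊓n≤n a m)
      reorder : ∀ p q r s → p * q * r * s ≡ s * p * (q * r)
      reorder = solve-∀
      reorder′ : ∀ d m y f → d * suc m * (y * f) ≡ d * y * (suc m * f)
      reorder′ = solve-∀

    run : ∀ V → Unique V → All LargeDegree V → 2 ^ m ≤ length V → Target
    run V !V hs large with classify V !V hs
    ... | inj₁ done = done
    ... | inj₂ C    = from-larger-part (m+m≤1+n+o⇒m≤n⊎m≤o (length xStars) (length mixedStars) halves)
      where
      open Classified C
      halves : 2 ^ (m ∸ 1) + 2 ^ (m ∸ 1) ≤ suc (length xStars + length mixedStars)
      halves = ≤-trans (2^[m∸1]+2^[m∸1]≤1+2^m m) (s≤s (subst (2 ^ m ≤_) split large))
      from-larger-part : 2 ^ (m ∸ 1) ≤ length xStars ⊎ 2 ^ (m ∸ 1) ≤ length mixedStars → Target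
      from-larger-part (inj₁ enough) = build-x xStars xCentres enough
      from-larger-part (inj₂ enough) = build-mixed mixedStars mixedCentres enough

  ∅-family : ∀ x A hi → CliqueFamily x A 0 hi [ ∅ ]
  ∅-family x A hi = [] ∷ [] , record
    { clique = λ _ _ i∈∅ → ⊥-elim (∉⊥ i∈∅) ; within = λ i∈∅ → ⊥-elim (∉⊥ i∈∅)
    ; lower = z≤n ; upper = subst (_≤ hi) (sym (∣⊥∣≡0 n)) z≤n } ∷ []

  trichotomy : ∀ m A → Unique A → 2 ^ m ≤ length A → ∀ a b → Trichotomy false true m A a b
  trichotomy m       A _ _ zero    b       = x-cliques z≤n [ ∅ ] (∅-family false A 0) (s≤s z≤n)
  trichotomy m       A _ _ (suc a) zero    = y-cliques z≤n [ ∅ ] (∅-family true A 0) (s≤s z≤n)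
  trichotomy zero    A _ _ (suc a) (suc b) = mixed [ ∅ ] [ ∅ ] (∅-family false A 0) (∅-family true A 0) (s≤s z≤n)
  trichotomy (suc m) A !A large (suc a) (suc b) =
    by-majority (m+m≤1+n+o⇒m≤n⊎m≤o (length red) (length blue) (m≤n⇒m≤1+n split))
    where
    Red? : ∀ v → Dec (2 ^ m ≤ length (neighbours false v A))
    Red? v = 2 ^ m ≤? length (neighbours false v A)
    red  = filter Red? A
    blue = filter (¬? ∘ Red?) A

    split : 2 ^ m + 2 ^ m ≤ length red + length blue
    split = begin
      2 ^ m + 2 ^ m             ≡⟨ 2^m+2^m≡2^[1+m] m ⟩
      2 ^ suc m                 ≤⟨ large ⟩
      length A                  ≤⟨ length≤filter+filter Red? (¬? ∘ Red?) (λ v → yes⊎no (Red? v)) A ⟩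
      length red + length blue  ∎
      where
      open ≤-Reasoning
      yes⊎no : ∀ {P : Set} → Dec P → P ⊎ ¬ P
      yes⊎no (yes p) = inj₁ p
      yes⊎no (no ¬p) = inj₂ ¬p

    redDegree : ∀ {v} → v ∈ₗ red → v ∈ₗ A × 2 ^ m ≤ length (neighbours false v A)
    redDegree = ∈-filter⁻ Red?

    blueDegree : ∀ {v} → v ∈ₗ blue → v ∈ₗ A × 2 ^ m ≤ length (neighbours true v A)
    blueDegree v∈ with ∈-filter⁻ (¬? ∘ Red?) v∈
    ... | v∈A , notRed with large-degree m _ !A large
    ...   | inj₁ isRed  = ⊥-elim (notRed isRed)
    ...   | inj₂ isBlue = v∈A , isBlue

    by-majority : 2 ^ m ≤ length red ⊎ 2 ^ m ≤ length blue → Trichotomy false true (suc m) A (suc a) (suc b)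
    by-majority (inj₁ enough) =
      InductionStep.run false true m a b A !A (λ A′ !A′ l → trichotomy m A′ !A′ l a (suc b))
        red (Unique.filter⁺ Red? !A) (All.tabulate redDegree) enough
    by-majority (inj₂ enough) = Trichotomy-swap
      (InductionStep.run true false m b a A !A (λ A′ !A′ l → Trichotomy-swap (trichotomy m A′ !A′ l (suc a) b))
        blue (Unique.filter⁺ (¬? ∘ Red?) !A) (All.tabulate blueDegree) enough)

∃-2k²≤n<2[1+k]² : ∀ N → Σ ℕ λ k → 2 * (k * k) ≤ N × N < 2 * (suc k * suc k)
∃-2k²≤n<2[1+k]² zero = 0 , z≤n , s≤s z≤n
∃-2k²≤n<2[1+k]² (suc N) with ∃-2k²≤n<2[1+k]² N
... | k , lower , upper with suc N <? 2 * (suc k * suc k)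
...   | yes below = k , m≤n⇒m≤1+n lower , below
...   | no  above = suc k , ≮⇒≥ above , ≤-trans (s≤s upper) (step k)
  where
  identity : ∀ k → 2 * (suc (suc k) * suc (suc k)) ≡ suc (2 * (suc k * suc k)) + (4 * k + 5)
  identity = solve-∀
  step : ∀ k → suc (2 * (suc k * suc k)) ≤ 2 * (suc (suc k) * suc (suc k))
  step k = ≤-trans (m≤m+n _ (4 * k + 5)) (≤-reflexive (sym (identity k)))

t≤k+k : ∀ {t k} → 2 ≤ t → t * t < 2 * (suc k * suc k) → t ≤ k + k
t≤k+k {t} {zero}  2≤t t²<2 = ⊥-elim (<⇒≱ t²<2 (≤-trans (s≤s (s≤s z≤n)) (*-mono-≤ 2≤t 2≤t)))
t≤k+k {t} {suc j} 2≤t t²<2[1+k]² with t ≤? suc j + suc j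
... | yes t≤2k = t≤2k
... | no  t≰2k = ⊥-elim (<⇒≱ t²<2[1+k]² (begin
  2 * (suc (suc j) * suc (suc j))                             ≤⟨ m≤m+n _ (1 + 4 * j + 2 * (j * j)) ⟩
  2 * (suc (suc j) * suc (suc j)) + (1 + 4 * j + 2 * (j * j))  ≡⟨ identity j ⟩
  suc (suc j + suc j) * suc (suc j + suc j)                   ≤⟨ *-mono-≤ (≰⇒> t≰2k) (≰⇒> t≰2k) ⟩
  t * t                                                       ∎))
  where
  open ≤-Reasoning
  identity : ∀ j → 2 * (suc (suc j) * suc (suc j)) + (1 + 4 * j + 2 * (j * j))
                 ≡ suc (suc j + suc j) * suc (suc j + suc j)
  identity = solve-∀

SizeInRange-between : ∀ {t k p} → 2 * (k * k) ≤ t * t → t ∸ k ≤ p → p ≤ k → SizeInRange t p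
SizeInRange-between {t} {k} {p} 2k²≤t² t∸k≤p p≤k = square≤ p≤k , square≤ t∸p≤k
  where
  square≤ : ∀ {q} → q ≤ k → 2 * (q * q) ≤ t * t
  square≤ q≤k = ≤-trans (*-monoʳ-≤ 2 (*-mono-≤ q≤k q≤k)) 2k²≤t²
  t∸p≤k : t ∸ p ≤ k
  t∸p≤k = m≤n+o⇒m∸n≤o t p (≤-trans (m≤n+m∸n t k) (≤-trans (+-monoʳ-≤ k t∸k≤p) (≤-reflexive (+-comm k p))))

s*s≤2φ[s]+3s : ∀ s → s * s ≤ 2 * φ s + 3 * s
s*s≤2φ[s]+3s zero             = z≤n
s*s≤2φ[s]+3s (suc zero)       = s≤s z≤n
s*s≤2φ[s]+3s (suc (suc r)) = begin
  suc (suc r) * suc (suc r)                ≡⟨ expand r ⟩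
  suc r * suc r + (2 * r + 3)              ≤⟨ +-monoˡ-≤ (2 * r + 3) (s*s≤2φ[s]+3s (suc r)) ⟩
  2 * φ (suc r) + 3 * suc r + (2 * r + 3)  ≡⟨ collect (φ (suc r)) r ⟩
  2 * (φ (suc r) + r) + 3 * suc (suc r)    ∎
  where
  open ≤-Reasoning
  expand : ∀ r → suc (suc r) * suc (suc r) ≡ suc r * suc r + (2 * r + 3)
  expand = solve-∀
  collect : ∀ f r → 2 * f + 3 * suc r + (2 * r + 3) ≡ 2 * (f + r) + 3 * suc (suc r)
  collect = solve-∀

k!≤tᵏ : ∀ {k t} → k ≤ t → k ! ≤ t ^ k
k!≤tᵏ {zero}  _   = s≤s z≤n
k!≤tᵏ {suc k} k<t = *-mono-≤ k<t (k!≤tᵏ (≤-trans (n≤1+n k) k<t))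

CountBound-intro : ∀ t N e i j → i * j ≡ 4 → t * t ≤ e * j → 2 ^ e ≤ (N * 2 ^ (3 * t) * t ^ t) ^ i →
  CountBound 3 t N
CountBound-intro t N e i j ij≡4 t²≤ej 2ᵉ≤Mⁱ = begin
  2 ^ (t * t)  ≤⟨ ^-monoʳ-≤ 2 t²≤ej ⟩
  2 ^ (e * j)  ≡⟨ ^-*-assoc 2 e j ⟨
  (2 ^ e) ^ j  ≤⟨ ^-monoˡ-≤ j 2ᵉ≤Mⁱ ⟩
  (M ^ i) ^ j  ≡⟨ ^-*-assoc M i j ⟩
  M ^ (i * j)  ≡⟨ cong (M ^_) ij≡4 ⟩
  M ^ 4        ∎
  where
  open ≤-Reasoning
  M = N * 2 ^ (3 * t) * t ^ t

CountBound-uniform : ∀ {t k N} → 1 ≤ t → k ≤ t → t * t < 2 * (suc k * suc k) → 2 ^ φ k ≤ N * k ! →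
  CountBound 3 t N
CountBound-uniform {t} {k} {N} 1≤t k≤t t²<2[1+k]² many =
  CountBound-intro t N (φ k + 3 * t) 1 4 refl exponent (begin
    2 ^ (φ k + 3 * t)    ≡⟨ ^-distribˡ-+-* 2 (φ k) (3 * t) ⟩
    2 ^ φ k * P          ≤⟨ *-monoˡ-≤ P (≤-trans many (*-monoʳ-≤ N k!≤tᵗ)) ⟩
    N * t ^ t * P        ≡⟨ reorder N (t ^ t) P ⟩
    (N * P * t ^ t) ^ 1  ∎)
  where
  open ≤-Reasoning
  P = 2 ^ (3 * t)
  k!≤tᵗ : k ! ≤ t ^ t
  k!≤tᵗ = ≤-trans (k!≤tᵏ k≤t) (^-monoʳ-≤ t ⦃ >-nonZero 1≤t ⦄ k≤t)
  reorder : ∀ n u p → n * u * p ≡ n * p * u * 1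
  reorder = solve-∀
  exponent : t * t ≤ (φ k + 3 * t) * 4
  exponent = ≤-pred (begin
    suc (t * t)                          ≤⟨ t²<2[1+k]² ⟩
    2 * (suc k * suc k)                  ≡⟨ e₁ k ⟩
    2 * (k * k) + (4 * k + 2)            ≤⟨ +-monoˡ-≤ (4 * k + 2) (*-monoʳ-≤ 2 (s*s≤2φ[s]+3s k)) ⟩
    2 * (2 * φ k + 3 * k) + (4 * k + 2)  ≡⟨ e₂ (φ k) k ⟩
    suc (4 * φ k + (10 * k + 1))         ≤⟨ s≤s (+-monoʳ-≤ (4 * φ k) slack) ⟩
    suc (4 * φ k + (10 * t + (t + t)))   ≡⟨ cong suc (e₃ (φ k) t) ⟩
    suc ((φ k + 3 * t) * 4)              ∎)
    where
    slack : 10 * k + 1 ≤ 10 * t + (t + t)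
    slack = +-mono-≤ (*-monoʳ-≤ 10 k≤t) (≤-trans 1≤t (m≤n+m t t))
    e₁ : ∀ k → 2 * (suc k * suc k) ≡ 2 * (k * k) + (4 * k + 2)
    e₁ = solve-∀
    e₂ : ∀ f k → 2 * (2 * f + 3 * k) + (4 * k + 2) ≡ suc (4 * f + (10 * k + 1))
    e₂ = solve-∀
    e₃ : ∀ f t → 4 * f + (10 * t + (t + t)) ≡ (f + 3 * t) * 4
    e₃ = solve-∀

CountBound-mixed : ∀ {t X Y N} → 1 ≤ t → X ≤ N → Y ≤ N → 2 ^ φ t ≤ X * Y * t ! → CountBound 3 t N
CountBound-mixed {t} {X} {Y} {N} 1≤t X≤N Y≤N many =
  CountBound-intro t N (φ t + 3 * t) 2 2 refl exponent (begin
    2 ^ (φ t + 3 * t)                ≡⟨ ^-distribˡ-+-* 2 (φ t) (3 * t) ⟩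
    2 ^ φ t * P                      ≤⟨ *-monoˡ-≤ P (≤-trans many (*-mono-≤ (*-mono-≤ X≤N Y≤N) (k!≤tᵏ {t} ≤-refl))) ⟩
    N * N * t ^ t * P                ≤⟨ m≤m*n (N * N * t ^ t * P) (P * t ^ t) ⦃ >-nonZero Ptᵗ>0 ⦄ ⟩
    N * N * t ^ t * P * (P * t ^ t)  ≡⟨ square N (t ^ t) P ⟩
    (N * P * t ^ t) ^ 2              ∎)
  where
  open ≤-Reasoning
  P = 2 ^ (3 * t)
  Ptᵗ>0 : 0 < P * t ^ t
  Ptᵗ>0 = *-mono-≤ (m^n>0 2 (3 * t)) (m^n>0 t ⦃ >-nonZero 1≤t ⦄ t)
  square : ∀ n u p → n * n * u * p * (p * u) ≡ (n * p * u) * ((n * p * u) * 1)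
  square = solve-∀
  exponent : t * t ≤ (φ t + 3 * t) * 2
  exponent = ≤-trans (s*s≤2φ[s]+3s t) (≤-trans (m≤m+n _ (3 * t)) (≤-reflexive (regroup (φ t) t)))
    where
    regroup : ∀ f t → 2 * f + 3 * t + 3 * t ≡ (f + 3 * t) * 2
    regroup = solve-∀

ManyMonochromaticCliques : ℕ → (t : ℕ) → Colouring (2 ^ t) → Set
ManyMonochromaticCliques C t c = Σ (List (Subset (2 ^ t))) λ Ss →
  Unique Ss × All (λ S → Monochromatic c S × SizeInRange t ∣ S ∣) Ss × CountBound C t (length Ss)

module _ {t k} (c : Colouring (2 ^ t)) (2≤t : 2 ≤ t)
  (2k²≤t² : 2 * (k * k) ≤ t * t) (t²<2[1+k]² : t * t < 2 * (suc k * suc k)) where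

  private
    1≤t = ≤-trans (s≤s z≤n) 2≤t
    t∸k≤k = m≤n+o⇒m∸n≤o t k (t≤k+k {t} {k} 2≤t t²<2[1+k]²)

    inRange : ∀ {x A lo hi L} → t ∸ k ≤ lo → hi ≤ k → CliqueFamily c x A lo hi L →
      All (λ S → Monochromatic c S × SizeInRange t ∣ S ∣) L
    inRange {x} {A} {lo} {hi} t∸k≤lo hi≤k (_ , cliques) = All.map inRange₁ cliques
      where
      inRange₁ : ∀ {S} → SizedClique c x A lo hi S → Monochromatic c S × SizeInRange t ∣ S ∣
      inRange₁ K = (_ , clique) , SizeInRange-between 2k²≤t² (≤-trans t∸k≤lo lower) (≤-trans upper hi≤k)
        where open SizedClique K

  Trichotomy⇒ManyMonochromaticCliques : ∀ {A} → Trichotomy c false true t A k k → ManyMonochromaticCliques 3 t c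
  Trichotomy⇒ManyMonochromaticCliques (x-cliques k≤t L F many) =
    L , proj₁ F , inRange t∸k≤k ≤-refl F , CountBound-uniform {N = length L} 1≤t k≤t t²<2[1+k]² many
  Trichotomy⇒ManyMonochromaticCliques (y-cliques k≤t L F many) =
    L , proj₁ F , inRange t∸k≤k ≤-refl F , CountBound-uniform {N = length L} 1≤t k≤t t²<2[1+k]² many
  Trichotomy⇒ManyMonochromaticCliques (mixed X Y F G many) with ≤-total (length X) (length Y)
  ... | inj₁ X≤Y = Y , proj₁ G , inRange ≤-refl (m⊓n≤m k t) G , CountBound-mixed 1≤t X≤Y ≤-refl many
  ... | inj₂ Y≤X = X , proj₁ F , inRange ≤-refl (m⊓n≤m k t) F , CountBound-mixed 1≤t ≤-refl Y≤X many

mainTheorem15 : Σ ℕ λ C → (1 ≤ C) × ((t : ℕ) → 2 ≤ t → (c : Colouring (2 ^ t)) →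
    Σ (List (Subset (2 ^ t))) λ Ss →
      Unique Ss × All (λ S → Monochromatic c S × SizeInRange t ∣ S ∣) Ss × CountBound C t (length Ss))
mainTheorem15 = 3 , s≤s z≤n , λ t 2≤t c →
  let k , 2k²≤t² , t²<2[1+k]² = ∃-2k²≤n<2[1+k]² (t * t)
      vertices = allFin (2 ^ t)
  in Trichotomy⇒ManyMonochromaticCliques c 2≤t 2k²≤t² t²<2[1+k]²
       (trichotomy c t vertices (Unique.allFin⁺ (2 ^ t)) (≤-reflexive (sym (length-tabulate id))) k k)
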